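{- Let $\mathrm{X}$ be the graph with vertex set $\{v_1,\dots,v_7\}$ and edge set $\{v_1v_2,v_1v_3,v_1v_6,v_1v_7,v_2v_3,v_2v_6,v_2v_7,v_3v_4,v_3v_5,v_4v_5,v_4v_6,v_4v_7,v_5v_6,v_5v_7\}$. Then $\langle\mathcal{H}(\mathrm{X})\rangle_{\mathbb{Z}/2}=\mathrm{Z}_1(\mathrm{X};\mathbb{Z}/2)$.
   Context: $\mathrm{Z}_1(\mathrm{X};\mathbb{Z}/2)$ is the cycle space of $\mathrm{X}$ over $\mathbb{Z}/2$; $\mathcal{H}(\mathrm{X})$ is the set of Hamilton circuits of $\mathrm{X}$, identified with their edge sets, and $\langle\mathcal{H}(\mathrm{X})\rangle_{\mathbb{Z}/2}$ is their $\mathbb{Z}/2$-span. -}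

module Defs where

open import Data.Bool using (Bool; true; false; _xor_; if_then_else_)
open import Data.Nat using (ℕ; zero; suc; _+_)
open import Data.Nat.DivMod using (_%_; m%n<n)
open import Data.Nat.Divisibility using (_∣_)
open import Data.Fin using (Fin; zero; suc; toℕ; fromℕ<; _≟_)
open import Data.Vec using (Vec; []; _∷_; lookup; replicate; zipWith; tabulate; foldr)
open import Data.List using (List)
open import Data.List.Relation.Unary.All using (All)
open import Data.Product using (Σ; ∃; _×_; _,_)
open import Data.Sum using (_⊎_)
open import Function.Definitions using (Injective)
open import Function.Bundles using (_⇔_)
open import Relation.Binary.PropositionalEquality using (_≡_)
open import Relation.Nullary.Decidable using (⌊_⌋)

-- Vertices v₁,…,v₇ are represented by 0,…,6 : Fin 7.
Vertex : Set
Vertex = Fin 7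

-- The 14 edges of X, in the order listed in the paper (0-indexed vertices).
Edge : Set
Edge = Fin 14

edgeList : Vec (Fin 7 × Fin 7) 14
edgeList =
    (v 0 , v 1) ∷ (v 0 , v 2) ∷ (v 0 , v 5) ∷ (v 0 , v 6) ∷ (v 1 , v 2)
  ∷ (v 1 , v 5) ∷ (v 1 , v 6) ∷ (v 2 , v 3) ∷ (v 2 , v 4) ∷ (v 3 , v 4)
  ∷ (v 3 , v 5) ∷ (v 3 , v 6) ∷ (v 4 , v 5) ∷ (v 4 , v 6) ∷ []
  where
  v : ℕ → Fin 7
  v n = fromℕ< (m%n<n n 7)

endpoints : Edge → Fin 7 × Fin 7
endpoints e = lookup edgeList e

Joins : Edge → Vertex → Vertex → Set
Joins e u w = (endpoints e ≡ (u , w)) ⊎ (endpoints e ≡ (w , u))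

-- Edge subsets of X (= 1-chains over ℤ/2).
EdgeSet : Set
EdgeSet = Vec Bool 14

_⊕_ : EdgeSet → EdgeSet → EdgeSet
_⊕_ = zipWith _xor_

∅ : EdgeSet
∅ = replicate 14 false

next : Fin 7 → Fin 7
next i = fromℕ< (m%n<n (suc (toℕ i)) 7)

IsHamiltonCircuit : EdgeSet → Set
IsHamiltonCircuit S =
  Σ (Fin 7 → Vertex) λ f →
    Injective _≡_ _≡_ f
    × (∀ i → ∃ λ e → Joins e (f i) (f (next i)))
    × (∀ e → (lookup S e ≡ true) ⇔ (∃ λ i → Joins e (f i) (f (next i))))

InHamSpan : EdgeSet → Set
InHamSpan S = Σ (List EdgeSet) λ L → All IsHamiltonCircuit L × (S ≡ Data.List.foldr _⊕_ ∅ L)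

isEndpoint : Vertex → Edge → Bool
isEndpoint v e with endpoints e
... | (a , b) = ⌊ v ≟ a ⌋ Data.Bool.∨ ⌊ v ≟ b ⌋

degree : EdgeSet → Vertex → ℕ
degree S v = foldr (λ _ → ℕ) _+_ 0
  (tabulate λ e → if lookup S e Data.Bool.∧ isEndpoint v e then 1 else 0)

-- Cycle space Z₁(X;ℤ/2) = ker ∂₁: every vertex has even degree.
InCycleSpace : EdgeSet → Set
InCycleSpace S = ∀ v → 2 ∣ degree S v

-- A vertex has even degree in S exactly when the ℤ/2-boundary ∂S vanishes there, and ∂ is
-- linear, so the cycle space is the kernel of ∂ and contains every sum of Hamilton circuits
-- once it contains each circuit. If f enumerates a Hamilton circuit, its edge set is the sum
-- of the distinct edges f(i)f(i+1), whose boundaries f(i) + f(i+1) cancel in pairs under the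
-- rotation i ↦ i + 1. Conversely, the cycle space has dimension 14 − 7 + 1 = 8; eight explicit
-- Hamilton circuits together with a dual family of edge sets express every cycle as a sum of
-- those circuits, which is checked over all 2¹⁴ edge sets.
module Submission where

open import Defs
open import Algebra.Bundles using (CommutativeRing)
open import Data.Bool using (Bool; true; false; not; _∧_; _∨_; _xor_; if_then_else_; T?)
import Data.Bool as Bool
open import Data.Bool.Properties
  using (xor-∧-commutativeRing; not-involutive; not-distribˡ-xor; ∧-distribʳ-xor; xor-comm; xor-same; xor-identityʳ)
open import Data.Fin using (Fin; zero; suc; toℕ; fromℕ<; #_; _≟_; punchIn)
open import Data.Fin.Properties using (all?; any?; punchInᵢ≢i)
open import Data.Fin.Permutation using (Permutation; permutation)
open import Data.List using (List; []; _∷_; map; filter; allFin)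
import Data.List as List
open import Data.List.Relation.Unary.All as All using (All; []; _∷_)
open import Data.List.Relation.Unary.All.Properties using (map⁺)
open import Data.Nat using (ℕ; zero; suc; _+_; _*_)
open import Data.Nat.DivMod using (m%n<n)
open import Data.Nat.Divisibility using (_∣_; divides; _∣0; ∣-refl; ∣m∣n⇒∣m+n)
open import Data.Product using (∃; _×_; _,_; proj₁; proj₂; uncurry; swap)
open import Data.Product.Properties using (,-injective) renaming (≡-dec to ×-≡-dec)
open import Data.Sum using (_⊎_; inj₁; inj₂) renaming (swap to ⊎-swap)
open import Data.Empty using (⊥-elim)
open import Data.Vec using (Vec; []; _∷_; lookup; tabulate)
import Data.Vec as Vec
open import Data.Vec.Properties using (≡-dec; lookup-zipWith; lookup-replicate; lookup∘tabulate)
open import Function.Base using (_∘_; case_of_)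
open import Function.Bundles using (_⇔_; mk⇔; Equivalence)
open import Function.Definitions using (Injective)
open import Relation.Binary.PropositionalEquality
  using (_≡_; _≢_; refl; sym; trans; cong; cong₂; subst; module ≡-Reasoning)
open import Relation.Nullary using (Dec; yes; no; does; ¬?)
open import Relation.Nullary.Decidable using (map′; _×-dec_; _⊎-dec_; _→-dec_; from-yes; dec-true; dec-false; ⌊_⌋)
open import Relation.Unary using (Decidable)

open import Algebra.Properties.Semiring.Sum (CommutativeRing.semiring xor-∧-commutativeRing)
  using (sum; sum-syntax; sum-cong-≗; sum-replicate-zero; sum-remove; ∑-distrib-+; ∑-comm; ∑-permute; *-distribʳ-sum)

open Equivalence using (to; from)

sum-zero : ∀ {n} (t : Fin n → Bool) → (∀ i → t i ≡ false) → sum t ≡ false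
sum-zero {n} t t≡false = trans (sum-cong-≗ t≡false) (sum-replicate-zero n)

sum-supportedAt : ∀ {n} (t : Fin n → Bool) k → (∀ j → j ≢ k → t j ≡ false) → sum t ≡ t k
sum-supportedAt {suc n} t k vanishes = begin
  sum t                          ≡⟨ sum-remove {i = k} t ⟩
  t k xor sum (t ∘ punchIn k)    ≡⟨ cong (t k xor_) (sum-zero (t ∘ punchIn k) λ j → vanishes _ (punchInᵢ≢i k j)) ⟩
  t k xor false                  ≡⟨ xor-identityʳ (t k) ⟩
  t k                            ∎
  where open ≡-Reasoning

∑-δ : ∀ {n} k (h : Fin n → Bool) → ∑[ j < n ] (does (j ≟ k) ∧ h j) ≡ h k
∑-δ k h = trans (sum-supportedAt _ k λ j j≢k → cong (_∧ h j) (dec-false (j ≟ k) j≢k))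
                (cong (_∧ h k) (dec-true (k ≟ k) refl))

indicator-of-image : ∀ {m n} {g : Fin n → Fin m} → Injective _≡_ _≡_ g →
                     ∀ {b} x → (b ≡ true ⇔ ∃ λ i → x ≡ g i) → b ≡ ∑[ i < n ] does (x ≟ g i)
indicator-of-image {g = g} g-injective {true} x b⇔ with to b⇔ refl
... | k , x≡gk = sym (trans (sum-supportedAt _ k λ i i≢k → dec-false (x ≟ g i) λ x≡gi → i≢k (g-injective (trans (sym x≡gi) x≡gk)))
                            (dec-true (x ≟ g k) x≡gk))
indicator-of-image {g = g} g-injective {false} x b⇔ =
  sym (sum-zero _ λ i → dec-false (x ≟ g i) λ x≡gi → case from b⇔ (i , x≡gi) of λ ())

odd : ℕ → Bool
odd zero    = false
odd (suc n) = not (odd n)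

odd-+ : ∀ m n → odd (m + n) ≡ odd m xor odd n
odd-+ zero    n = refl
odd-+ (suc m) n = trans (cong not (odd-+ m n)) (not-distribˡ-xor (odd m) (odd n))

odd-count≡sum : ∀ {n} (b : Fin n → Bool) →
            odd (Vec.foldr (λ _ → ℕ) _+_ 0 (tabulate λ i → if b i then 1 else 0)) ≡ sum b
odd-count≡sum {zero}  b = refl
odd-count≡sum {suc n} b =
  trans (odd-+ (if b zero then 1 else 0) _) (cong₂ _xor_ (odd-indicator (b zero)) (odd-count≡sum (b ∘ suc)))
  where
  odd-indicator : ∀ x → odd (if x then 1 else 0) ≡ x
  odd-indicator true  = refl
  odd-indicator false = refl

2∣⇔odd≡false : ∀ {n} → 2 ∣ n ⇔ odd n ≡ false
2∣⇔odd≡false = mk⇔ (λ { (divides q refl) → odd-double q }) (even⇒2∣ _)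
  where
  odd-double : ∀ q → odd (q * 2) ≡ false
  odd-double zero    = refl
  odd-double (suc q) = trans (not-involutive _) (odd-double q)

  even⇒2∣ : ∀ n → odd n ≡ false → 2 ∣ n
  even⇒2∣ zero          _    = 2 ∣0
  even⇒2∣ (suc (suc n)) even = ∣m∣n⇒∣m+n ∣-refl (even⇒2∣ n (trans (sym (not-involutive _)) even))

all-Vec? : ∀ {n p} {P : Vec Bool n → Set p} → Decidable P → Dec (∀ xs → P xs)
all-Vec? {zero}  P? = map′ (λ { p [] → p }) (λ ∀P → ∀P []) (P? [])
all-Vec? {suc n} P? =
  map′ (λ { (∀P₁ , ∀P₀) (true ∷ xs) → ∀P₁ xs ; (∀P₁ , ∀P₀) (false ∷ xs) → ∀P₀ xs })
       (λ ∀P → ∀P ∘ (true ∷_) , ∀P ∘ (false ∷_))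
       (all-Vec? (P? ∘ (true ∷_)) ×-dec all-Vec? (P? ∘ (false ∷_)))

injective? : ∀ {m n} (g : Fin m → Fin n) → Dec (Injective _≡_ _≡_ g)
injective? g = map′ (λ inj {x} {y} → inj x y) (λ inj x y → inj)
                    (all? λ x → all? λ y → (g x ≟ g y) →-dec (x ≟ y))

does⇔ : ∀ {p} {P : Set p} (P? : Dec P) → does P? ≡ true ⇔ P
does⇔ (yes p) = mk⇔ (λ _ → p) (λ _ → refl)
does⇔ (no ¬p) = mk⇔ (λ ()) (⊥-elim ∘ ¬p)

boundary : EdgeSet → Vertex → Bool
boundary S v = ∑[ e < 14 ] (lookup S e ∧ isEndpoint v e)

IsCycle : EdgeSet → Set
IsCycle S = ∀ v → boundary S v ≡ false

isCycle? : Decidable IsCycle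
isCycle? S = all? λ v → boundary S v Bool.≟ false

inCycleSpace⇔isCycle : ∀ S → InCycleSpace S ⇔ IsCycle S
inCycleSpace⇔isCycle S = mk⇔ (λ even v → to (even-degree⇔ v) (even v)) (λ cycle v → from (even-degree⇔ v) (cycle v))
  where
  even-degree⇔ : ∀ v → 2 ∣ degree S v ⇔ boundary S v ≡ false
  even-degree⇔ v = subst (λ b → 2 ∣ degree S v ⇔ b ≡ false) (odd-count≡sum (λ e → lookup S e ∧ isEndpoint v e)) 2∣⇔odd≡false

boundary-⊕ : ∀ S T v → boundary (S ⊕ T) v ≡ boundary S v xor boundary T v
boundary-⊕ S T v = begin
  ∑[ e < 14 ] (lookup (S ⊕ T) e ∧ isEndpoint v e)
    ≡⟨ sum-cong-≗ (λ e → cong (_∧ isEndpoint v e) (lookup-zipWith _xor_ e S T)) ⟩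
  ∑[ e < 14 ] ((lookup S e xor lookup T e) ∧ isEndpoint v e)
    ≡⟨ sum-cong-≗ (λ e → ∧-distribʳ-xor (isEndpoint v e) (lookup S e) (lookup T e)) ⟩
  ∑[ e < 14 ] ((lookup S e ∧ isEndpoint v e) xor (lookup T e ∧ isEndpoint v e))
    ≡⟨ ∑-distrib-+ (λ e → lookup S e ∧ isEndpoint v e) (λ e → lookup T e ∧ isEndpoint v e) ⟩
  boundary S v xor boundary T v ∎
  where open ≡-Reasoning

boundary-∅ : ∀ v → boundary ∅ v ≡ false
boundary-∅ v = sum-zero (λ e → lookup ∅ e ∧ isEndpoint v e) λ e → cong (_∧ isEndpoint v e) (lookup-replicate e false)

⨁ : List EdgeSet → EdgeSet
⨁ = List.foldr _⊕_ ∅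

⨁-isCycle : ∀ {L} → All IsCycle L → IsCycle (⨁ L)
⨁-isCycle []                       v = boundary-∅ v
⨁-isCycle {S ∷ L} (cycle ∷ cycles) v = trans (boundary-⊕ S (⨁ L) v) (cong₂ _xor_ (cycle v) (⨁-isCycle cycles v))

Joins? : ∀ e a b → Dec (Joins e a b)
Joins? e a b = ×-≡-dec _≟_ _≟_ (endpoints e) (a , b) ⊎-dec ×-≡-dec _≟_ _≟_ (endpoints e) (b , a)

Adjacent : Vertex → Vertex → Set
Adjacent a b = ∃ λ e → Joins e a b

adjacent? : ∀ a b → Dec (Adjacent a b)
adjacent? a b = any? λ e → Joins? e a b

no-parallel-edges : ∀ e e′ → Joins e (proj₁ (endpoints e′)) (proj₂ (endpoints e′)) → e ≡ e′
no-parallel-edges = from-yes (all? λ e → all? λ e′ → Joins? e (proj₁ (endpoints e′)) (proj₂ (endpoints e′)) →-dec (e ≟ e′))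

Joins-unique : ∀ {e e′ a b} → Joins e a b → Joins e′ a b → e ≡ e′
Joins-unique {e} {e′} joins (inj₁ ends) =
  no-parallel-edges e e′ (subst (uncurry (Joins e)) (sym ends) joins)
Joins-unique {e} {e′} joins (inj₂ ends) =
  no-parallel-edges e e′ (subst (uncurry (Joins e)) (sym ends) (⊎-swap joins))

Joins-same-ends : ∀ {e a b c d} → Joins e a b → Joins e c d → (a ≡ c × b ≡ d) ⊎ (a ≡ d × b ≡ c)
Joins-same-ends (inj₁ ab) (inj₁ cd) = inj₁ (,-injective (trans (sym ab) cd))
Joins-same-ends (inj₁ ab) (inj₂ dc) = inj₂ (,-injective (trans (sym ab) dc))
Joins-same-ends (inj₂ ba) (inj₁ cd) = inj₂ (swap (,-injective (trans (sym ba) cd)))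
Joins-same-ends (inj₂ ba) (inj₂ dc) = inj₁ (swap (,-injective (trans (sym ba) dc)))

∨≡xor-at-distinct : ∀ {n} {a b : Fin n} v → a ≢ b → ⌊ v ≟ a ⌋ ∨ ⌊ v ≟ b ⌋ ≡ does (v ≟ a) xor does (v ≟ b)
∨≡xor-at-distinct {a = a} {b} v a≢b with v ≟ a | v ≟ b
... | yes refl | yes refl = ⊥-elim (a≢b refl)
... | yes _    | no _     = refl
... | no _     | yes _    = refl
... | no _     | no _     = refl

isEndpoint-joins : ∀ {e a b} v → Joins e a b → a ≢ b → isEndpoint v e ≡ does (v ≟ a) xor does (v ≟ b)
isEndpoint-joins v (inj₁ ends) a≢b rewrite ends = ∨≡xor-at-distinct v a≢b
isEndpoint-joins {a = a} {b} v (inj₂ ends) a≢b rewrite ends =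
  trans (∨≡xor-at-distinct v (a≢b ∘ sym)) (xor-comm (does (v ≟ b)) (does (v ≟ a)))

next-irreflexive : ∀ i → next i ≢ i
next-irreflexive = from-yes (all? λ i → ¬? (next i ≟ i))

next²-irreflexive : ∀ i → next (next i) ≢ i
next²-irreflexive = from-yes (all? λ i → ¬? (next (next i) ≟ i))

next-no-2-cycle : ∀ {i j} → i ≡ next j → next i ≢ j
next-no-2-cycle {j = j} refl = next²-irreflexive j

previous : Fin 7 → Fin 7
previous i = fromℕ< (m%n<n (toℕ i + 6) 7)

rotation : Permutation 7 7
rotation = permutation next previous (from-yes (all? λ i → next (previous i) ≟ i))
                                     (from-yes (all? λ i → previous (next i) ≟ i))

OnCircuit : (Fin 7 → Vertex) → Edge → Set
OnCircuit f e = ∃ λ i → Joins e (f i) (f (next i))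

onCircuit? : ∀ f e → Dec (OnCircuit f e)
onCircuit? f e = any? λ i → Joins? e (f i) (f (next i))

IsHamiltonOrder : (Fin 7 → Vertex) → Set
IsHamiltonOrder f = Injective _≡_ _≡_ f × (∀ i → Adjacent (f i) (f (next i)))

isHamiltonOrder? : ∀ f → Dec (IsHamiltonOrder f)
isHamiltonOrder? f = injective? f ×-dec all? λ i → adjacent? (f i) (f (next i))

module HamiltonCircuit
  (S : EdgeSet) (f : Fin 7 → Vertex) (f-injective : Injective _≡_ _≡_ f)
  (consecutive : ∀ i → Adjacent (f i) (f (next i))) (S⇔ : ∀ e → lookup S e ≡ true ⇔ OnCircuit f e)
  where

  edgeAt : Fin 7 → Edge
  edgeAt i = proj₁ (consecutive i)

  edgeAt-joins : ∀ i → Joins (edgeAt i) (f i) (f (next i))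
  edgeAt-joins i = proj₂ (consecutive i)

  consecutive-distinct : ∀ i → f i ≢ f (next i)
  consecutive-distinct i = next-irreflexive i ∘ sym ∘ f-injective

  edgeAt-injective : Injective _≡_ _≡_ edgeAt
  edgeAt-injective {i} {j} same
    with Joins-same-ends {edgeAt i} (edgeAt-joins i) (subst (λ e → Joins e (f j) (f (next j))) (sym same) (edgeAt-joins j))
  ... | inj₁ (fi≡fj , _)       = f-injective fi≡fj
  ... | inj₂ (fi≡fnj , fni≡fj) = ⊥-elim (next-no-2-cycle (f-injective fi≡fnj) (f-injective fni≡fj))

  lookup-S≡∑ : ∀ e → lookup S e ≡ ∑[ i < 7 ] does (e ≟ edgeAt i)
  lookup-S≡∑ e = indicator-of-image edgeAt-injective e (mk⇔ on-circuit-edge circuit-edge-in-S)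
    where
    on-circuit-edge : lookup S e ≡ true → ∃ λ i → e ≡ edgeAt i
    on-circuit-edge e∈S with to (S⇔ e) e∈S
    ... | i , joins = i , Joins-unique joins (edgeAt-joins i)

    circuit-edge-in-S : (∃ λ i → e ≡ edgeAt i) → lookup S e ≡ true
    circuit-edge-in-S (i , refl) = from (S⇔ e) (i , edgeAt-joins i)

  isCycle : IsCycle S
  isCycle v = begin
    ∑[ e < 14 ] (lookup S e ∧ isEndpoint v e)
      ≡⟨ sum-cong-≗ (λ e → cong (_∧ isEndpoint v e) (lookup-S≡∑ e)) ⟩
    ∑[ e < 14 ] ((∑[ i < 7 ] does (e ≟ edgeAt i)) ∧ isEndpoint v e)
      ≡⟨ sum-cong-≗ (λ e → *-distribʳ-sum (isEndpoint v e) (λ i → does (e ≟ edgeAt i))) ⟩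
    ∑[ e < 14 ] ∑[ i < 7 ] (does (e ≟ edgeAt i) ∧ isEndpoint v e)
      ≡⟨ ∑-comm (λ e i → does (e ≟ edgeAt i) ∧ isEndpoint v e) ⟩
    ∑[ i < 7 ] ∑[ e < 14 ] (does (e ≟ edgeAt i) ∧ isEndpoint v e)
      ≡⟨ sum-cong-≗ (λ i → ∑-δ (edgeAt i) (isEndpoint v)) ⟩
    ∑[ i < 7 ] isEndpoint v (edgeAt i)
      ≡⟨ sum-cong-≗ (λ i → isEndpoint-joins {edgeAt i} v (edgeAt-joins i) (consecutive-distinct i)) ⟩
    ∑[ i < 7 ] (does (v ≟ f i) xor does (v ≟ f (next i)))
      ≡⟨ ∑-distrib-+ (λ i → does (v ≟ f i)) (λ i → does (v ≟ f (next i))) ⟩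
    ∑[ i < 7 ] does (v ≟ f i) xor ∑[ i < 7 ] does (v ≟ f (next i))
      ≡⟨ cong (∑[ i < 7 ] does (v ≟ f i) xor_) (∑-permute (λ i → does (v ≟ f i)) rotation) ⟨
    ∑[ i < 7 ] does (v ≟ f i) xor ∑[ i < 7 ] does (v ≟ f i)
      ≡⟨ xor-same (∑[ i < 7 ] does (v ≟ f i)) ⟩
    false ∎
    where open ≡-Reasoning

hamiltonCircuit-isCycle : ∀ {S} → IsHamiltonCircuit S → IsCycle S
hamiltonCircuit-isCycle {S} (f , f-injective , consecutive , S⇔) = HamiltonCircuit.isCycle S f f-injective consecutive S⇔

circuitEdges : (Fin 7 → Vertex) → EdgeSet
circuitEdges f = tabulate λ e → does (onCircuit? f e)

circuitEdges-isHamiltonCircuit : ∀ f → IsHamiltonOrder f → IsHamiltonCircuit (circuitEdges f)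
circuitEdges-isHamiltonCircuit f (f-injective , consecutive) = f , f-injective , consecutive , λ e →
  subst (λ b → b ≡ true ⇔ OnCircuit f e) (sym (lookup∘tabulate (does ∘ onCircuit? f) e)) (does⇔ (onCircuit? f e))

hamiltonOrders : Vec (Vec Vertex 7) 8
hamiltonOrders =
    (# 0 ∷ # 6 ∷ # 4 ∷ # 5 ∷ # 3 ∷ # 2 ∷ # 1 ∷ [])
  ∷ (# 0 ∷ # 5 ∷ # 4 ∷ # 6 ∷ # 3 ∷ # 2 ∷ # 1 ∷ [])
  ∷ (# 0 ∷ # 6 ∷ # 3 ∷ # 5 ∷ # 4 ∷ # 2 ∷ # 1 ∷ [])
  ∷ (# 0 ∷ # 5 ∷ # 3 ∷ # 6 ∷ # 4 ∷ # 2 ∷ # 1 ∷ [])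
  ∷ (# 0 ∷ # 6 ∷ # 4 ∷ # 2 ∷ # 3 ∷ # 5 ∷ # 1 ∷ [])
  ∷ (# 0 ∷ # 2 ∷ # 4 ∷ # 6 ∷ # 3 ∷ # 5 ∷ # 1 ∷ [])
  ∷ (# 0 ∷ # 5 ∷ # 4 ∷ # 2 ∷ # 3 ∷ # 6 ∷ # 1 ∷ [])
  ∷ (# 0 ∷ # 6 ∷ # 4 ∷ # 3 ∷ # 5 ∷ # 1 ∷ # 2 ∷ [])
  ∷ []

hamiltonOrder : Fin 8 → Fin 7 → Vertex
hamiltonOrder j = lookup (lookup hamiltonOrders j)

hamiltonBasis : Fin 8 → EdgeSet
hamiltonBasis j = circuitEdges (hamiltonOrder j)

hamiltonOrder-valid : ∀ j → IsHamiltonOrder (hamiltonOrder j)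
hamiltonOrder-valid = from-yes (all? (isHamiltonOrder? ∘ hamiltonOrder))

hamiltonBasis-isHamiltonCircuit : ∀ j → IsHamiltonCircuit (hamiltonBasis j)
hamiltonBasis-isHamiltonCircuit j = circuitEdges-isHamiltonCircuit (hamiltonOrder j) (hamiltonOrder-valid j)

-- Summed over dualSupports j, hamiltonBasis j has an odd number of edges and each other basis
-- circuit an even number, so coordinate j S is the coefficient of hamiltonBasis j in a cycle S.
dualSupports : Vec (List Edge) 8
dualSupports =
    (# 0 ∷ # 1 ∷ # 5 ∷ # 7 ∷ # 9 ∷ # 10 ∷ [])
  ∷ (# 4 ∷ # 5 ∷ # 9 ∷ # 10 ∷ [])
  ∷ (# 1 ∷ # 2 ∷ # 7 ∷ # 10 ∷ [])
  ∷ (# 0 ∷ # 2 ∷ # 9 ∷ # 10 ∷ [])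
  ∷ (# 1 ∷ # 5 ∷ [])
  ∷ (# 1 ∷ # 9 ∷ [])
  ∷ (# 0 ∷ # 4 ∷ # 5 ∷ [])
  ∷ (# 9 ∷ [])
  ∷ []

coordinate : Fin 8 → EdgeSet → Bool
coordinate j S = List.foldr _xor_ false (map (lookup S) (lookup dualSupports j))

decomposition : EdgeSet → List EdgeSet
decomposition S = map hamiltonBasis (filter (λ j → T? (coordinate j S)) (allFin 8))

decomposition-hamiltonian : ∀ S → All IsHamiltonCircuit (decomposition S)
decomposition-hamiltonian S = map⁺ (All.universal hamiltonBasis-isHamiltonCircuit _)

cycle-decomposes : ∀ S → IsCycle S → S ≡ ⨁ (decomposition S)
cycle-decomposes = from-yes (all-Vec? λ S → isCycle? S →-dec ≡-dec Bool._≟_ S (⨁ (decomposition S)))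

proposition5p5 : (S : EdgeSet) → InHamSpan S ⇔ InCycleSpace S
proposition5p5 S = mk⇔ span⇒cycleSpace cycleSpace⇒span
  where
  span⇒cycleSpace : InHamSpan S → InCycleSpace S
  span⇒cycleSpace (L , circuits , refl) =
    from (inCycleSpace⇔isCycle (⨁ L)) (⨁-isCycle (All.map (λ {H} → hamiltonCircuit-isCycle {H}) circuits))

  cycleSpace⇒span : InCycleSpace S → InHamSpan S
  cycleSpace⇒span even =
    decomposition S , decomposition-hamiltonian S , cycle-decomposes S (to (inCycleSpace⇔isCycle S) even)
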